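{- Let $G$ be a digraph and $w\in V(G)$. If a function $\mathbf{y}\colon V(G)\to\mathbb{R}$ satisfies $\sum_{v\in G^+(u)}\mathbf{y}(v)=0$ for all $u\in V(G)\setminus\{w\}$ and $w$ is a laevo-core vertex, then $\sum_{v\in G^+(w)}\mathbf{y}(v)=0$, and thus $\mathbf{y}\in\operatorname{Ker}G$. Similarly, if $\mathbf{y}$ satisfies $\sum_{v\in G^-(u)}\mathbf{y}(v)=0$ for all $u\in V(G)\setminus\{w\}$ and $w$ is a dextro-core vertex, then $\sum_{v\in G^-(w)}\mathbf{y}(v)=0$, and thus $\mathbf{y}\in\operatorname{CoKer}G$.
   Context: A digraph $G$ is a finite nonempty vertex set $V(G)$ with an arbitrary binary relation $\to$. Write $G^+(v)=\{u: v\to u\}$, $G^-(v)=\{u:u\to v\}$. $\operatorname{Ker}G=\{\mathbf{x}\colon V(G)\to\mathbb{R} : \sum_{u\in G^+(v)}\mathbf{x}(u)=0\ \forall v\}$ and $\operatorname{CoKer}G=\{\mathbf{x} : \sum_{u\in G^-(v)}\mathbf{x}(u)=0\ \forall v\}$. A vertex $w$ is dextro-core if some $\mathbf{x}\in\operatorname{Ker}G$ has $\mathbf{x}(w)\ne0$, and laevo-core if some $\mathbf{y}\in\operatorname{CoKer}G$ has $\mathbf{y}(w)\neq 0$. -}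

module Defs where

open import Level using (_⊔_)
open import Data.Nat using (ℕ; zero; suc)
open import Data.Fin using (Fin; zero; suc)
open import Data.Bool using (Bool; if_then_else_)
open import Data.Product using (∃; _×_)
open import Data.Sum using (_⊎_)
open import Relation.Nullary using (¬_)
open import Algebra.Bundles using (CommutativeRing)

-- A digraph on vertex set Fin n is given by its (arbitrary) binary relation,
-- as a Boolean adjacency function: adj v u = true  iff  v → u.
Digraph : ℕ → Set
Digraph n = Fin n → Fin n → Bool

module _ {c ℓ} (R : CommutativeRing c ℓ) where
  open CommutativeRing R using (Carrier; _≈_; _+_; _*_; 0#)

  -- ℝ is replaced by an arbitrary commutative ring without zero divisors
  NoZeroDivisors : Set (c ⊔ ℓ)
  NoZeroDivisors = ∀ a b → a * b ≈ 0# → a ≈ 0# ⊎ b ≈ 0#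

  sumᶠ : ∀ {n} → (Fin n → Carrier) → Carrier
  sumᶠ {zero}  f = 0#
  sumᶠ {suc n} f = f zero + sumᶠ (λ i → f (suc i))

  outSum : ∀ {n} → Digraph n → (Fin n → Carrier) → Fin n → Carrier
  outSum G x v = sumᶠ (λ u → if G v u then x u else 0#)

  inSum : ∀ {n} → Digraph n → (Fin n → Carrier) → Fin n → Carrier
  inSum G x v = sumᶠ (λ u → if G u v then x u else 0#)

  InKer : ∀ {n} → Digraph n → (Fin n → Carrier) → Set ℓ
  InKer G x = ∀ v → outSum G x v ≈ 0#

  InCoKer : ∀ {n} → Digraph n → (Fin n → Carrier) → Set ℓ
  InCoKer G x = ∀ v → inSum G x v ≈ 0#

  DextroCore : ∀ {n} → Digraph n → Fin n → Set (c ⊔ ℓ)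
  DextroCore G w = ∃ λ x → InKer G x × ¬ (x w ≈ 0#)

  LaevoCore : ∀ {n} → Digraph n → Fin n → Set (c ⊔ ℓ)
  LaevoCore G w = ∃ λ y → InCoKer G y × ¬ (y w ≈ 0#)

{-# OPTIONS --safe #-}
module Submission where

-- Let z ∈ CoKer G with z(w) ≠ 0. Summing z(u)·(Σ_{v ∈ G⁺(u)} y(v)) over all u and
-- swapping the order of summation gives Σ_v y(v)·(Σ_{u ∈ G⁻(v)} z(u)) = 0. Every term on
-- the left except u = w vanishes by hypothesis, so z(w)·(Σ_{v ∈ G⁺(w)} y(v)) = 0, and
-- z(w) ≠ 0 forces the sum at w to vanish. The second half is the first for the reversed
-- digraph, which swaps G⁺ with G⁻, Ker with CoKer and laevo- with dextro-core vertices.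

open import Defs
open import Data.Nat using (zero; suc)
open import Data.Fin using (Fin; zero; suc; punchIn)
open import Data.Fin.Properties using (_≟_; punchInᵢ≢i)
open import Data.Bool using (true; false; if_then_else_)
open import Data.Product using (_×_; _,_)
open import Data.Sum using (inj₁; inj₂)
open import Data.Empty using (⊥-elim)
open import Function using (flip)
open import Relation.Nullary using (¬_; yes; no)
open import Relation.Binary.PropositionalEquality using (_≡_; cong)
import Relation.Binary.PropositionalEquality as ≡
open import Algebra.Bundles using (CommutativeRing)
import Algebra.Properties.Semiring.Sum as SemiringSum
import Relation.Binary.Reasoning.Setoid as SetoidReasoning

module _ {c ℓ} (R : CommutativeRing c ℓ) where
  open CommutativeRing R hiding (zero)
  open SemiringSum semiring using (sum; sum-cong-≋; sum-remove; sum-replicate-zero; ∑-comm; *-distribˡ-sum)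
  open SetoidReasoning setoid

  sumᶠ≡sum : ∀ {n} (f : Fin n → Carrier) → sumᶠ R f ≡ sum f
  sumᶠ≡sum {zero}  f = ≡.refl
  sumᶠ≡sum {suc n} f = cong (f zero +_) (sumᶠ≡sum (λ i → f (suc i)))

  sum-supported : ∀ {n} (f : Fin n → Carrier) (w : Fin n) →
                  (∀ u → ¬ u ≡ w → f u ≈ 0#) → sum f ≈ f w
  sum-supported {suc n} f w f≈0 = begin
    sum f                                  ≈⟨ sum-remove f ⟩
    f w + sum (λ j → f (punchIn w j))      ≈⟨ +-congˡ (sum-cong-≋ {n} (λ j → f≈0 _ (punchInᵢ≢i w j))) ⟩
    f w + sum {n} (λ _ → 0#)               ≈⟨ +-congˡ (sum-replicate-zero n) ⟩
    f w + 0#                               ≈⟨ +-identityʳ (f w) ⟩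
    f w                                    ∎

  *-distribˡ-if : ∀ b a x → a * (if b then x else 0#) ≈ (if b then a * x else 0#)
  *-distribˡ-if true  a x = refl
  *-distribˡ-if false a x = zeroʳ a

  *-distribˡ-if-comm : ∀ b a x → x * (if b then a else 0#) ≈ (if b then a * x else 0#)
  *-distribˡ-if-comm true  a x = *-comm x a
  *-distribˡ-if-comm false a x = zeroʳ x

  *-distribˡ-sumᶠ : ∀ {n} a (f : Fin n → Carrier) → a * sumᶠ R f ≈ sum (λ i → a * f i)
  *-distribˡ-sumᶠ a f = trans (reflexive (cong (a *_) (sumᶠ≡sum f))) (*-distribˡ-sum a f)

  outSum-inSum-adjoint : ∀ {n} (G : Digraph n) (z y : Fin n → Carrier) →
    sum (λ u → z u * outSum R G y u) ≈ sum (λ v → y v * inSum R G z v)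
  outSum-inSum-adjoint {n} G z y = begin
    sum (λ u → z u * outSum R G y u)
      ≈⟨ sum-cong-≋ {n} (λ u → *-distribˡ-sumᶠ {n} (z u) _) ⟩
    sum (λ u → sum (λ v → z u * (if G u v then y v else 0#)))
      ≈⟨ sum-cong-≋ {n} (λ u → sum-cong-≋ {n} (λ v → *-distribˡ-if (G u v) (z u) (y v))) ⟩
    sum (λ u → sum (λ v → if G u v then z u * y v else 0#))
      ≈⟨ ∑-comm {n} {n} _ ⟩
    sum (λ v → sum (λ u → if G u v then z u * y v else 0#))
      ≈⟨ sum-cong-≋ {n} (λ v → sum-cong-≋ {n} (λ u → *-distribˡ-if-comm (G u v) (z u) (y v))) ⟨
    sum (λ v → sum (λ u → y v * (if G u v then z u else 0#)))
      ≈⟨ sum-cong-≋ {n} (λ v → *-distribˡ-sumᶠ {n} (y v) _) ⟨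
    sum (λ v → y v * inSum R G z v)
      ∎

  outSum-zero-at-laevoCore : NoZeroDivisors R → ∀ {n} (G : Digraph n) (w : Fin n) (y : Fin n → Carrier) →
    (∀ u → ¬ u ≡ w → outSum R G y u ≈ 0#) → LaevoCore R G w → outSum R G y w ≈ 0#
  outSum-zero-at-laevoCore noZeroDivisors {n} G w y outSum≈0 (z , z∈CoKer , z[w]≉0)
    with noZeroDivisors (z w) (outSum R G y w) pairing≈0
    where
    pairing≈0 : z w * outSum R G y w ≈ 0#
    pairing≈0 = begin
      z w * outSum R G y w              ≈⟨ sum-supported _ w (λ u u≢w → trans (*-congˡ (outSum≈0 u u≢w)) (zeroʳ (z u))) ⟨
      sum (λ u → z u * outSum R G y u)  ≈⟨ outSum-inSum-adjoint G z y ⟩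
      sum (λ v → y v * inSum R G z v)   ≈⟨ sum-cong-≋ {n} (λ v → trans (*-congˡ (z∈CoKer v)) (zeroʳ (y v))) ⟩
      sum {n} (λ _ → 0#)                ≈⟨ sum-replicate-zero n ⟩
      0#                                ∎
  ... | inj₁ z[w]≈0      = ⊥-elim (z[w]≉0 z[w]≈0)
  ... | inj₂ outSum[w]≈0 = outSum[w]≈0

  inKer-of-laevoCore : NoZeroDivisors R → ∀ {n} (G : Digraph n) (w : Fin n) (y : Fin n → Carrier) →
    (∀ u → ¬ u ≡ w → outSum R G y u ≈ 0#) → LaevoCore R G w →
    outSum R G y w ≈ 0# × InKer R G y
  inKer-of-laevoCore noZeroDivisors G w y outSum≈0 core = at-w , everywhere
    where
    at-w : outSum R G y w ≈ 0#
    at-w = outSum-zero-at-laevoCore noZeroDivisors G w y outSum≈0 core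
    everywhere : InKer R G y
    everywhere u with u ≟ w
    ... | yes ≡.refl = at-w
    ... | no  u≢w  = outSum≈0 u u≢w

lemma12 : ∀ {c ℓ} (R : CommutativeRing c ℓ) → NoZeroDivisors R →
    ∀ {n} (G : Digraph n) (w : Fin n) (y : Fin n → CommutativeRing.Carrier R) →
    (((∀ u → ¬ u ≡ w → CommutativeRing._≈_ R (outSum R G y u) (CommutativeRing.0# R)) →
       LaevoCore R G w →
       CommutativeRing._≈_ R (outSum R G y w) (CommutativeRing.0# R) × InKer R G y)
    ×
    ((∀ u → ¬ u ≡ w → CommutativeRing._≈_ R (inSum R G y u) (CommutativeRing.0# R)) →
       DextroCore R G w →
       CommutativeRing._≈_ R (inSum R G y w) (CommutativeRing.0# R) × InCoKer R G y))
lemma12 R noZeroDivisors G w y =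
  inKer-of-laevoCore R noZeroDivisors G w y ,
  inKer-of-laevoCore R noZeroDivisors (flip G) w y
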